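{- Let $n\ge2$ be even and $p=n/2$. There exists a unique $w_n\in\mathcal F_n$ with $\tau_{\mathbf m}(w_n)=\{s_p\}$. Moreover, for $n\ge4$, $w_n=\nu_p(\rho_n(w_{n-2}))$.
   Context: For even $m$: $S_m$ symmetric group, $s_i=(i,i+1)$, $S=\{s_1,\dots,s_{m-1}\}$, $\ell$ length, $\mathcal F_m$ the fixed-point-free involutions of $S_m$ with Bruhat order $\le$ the weakest partial order with $z\le tzt$ for transpositions $t$ with $\ell(z)\le\ell(tzt)$; $\tau_{\mathbf m}(z)=\{s\in S: szs\le z\}$. View $S_{n-2}\subset S_n$ fixing $n-1,n$; $w_0$ longest element of $S_n$; $\rho_n(z)=w_0zs_{n-1}w_0$ for $z\in\mathcal F_{n-2}$; $\sigma_p=s_ps_{p-1}\cdots s_1$; $\nu_p(x)=\sigma_px\sigma_p^{ -1}$. -}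

module Defs where

open import Data.Nat using (ℕ; zero; suc; _+_; _∸_; _≤_; _<_; _<?_; _≤?_)
open import Data.Fin using (Fin; toℕ; fromℕ<; inject₁; opposite) renaming (_<_ to _<ᶠ_; _≟_ to _≟ᶠ_)
open import Data.Vec using (Vec; lookup; tabulate)
open import Data.List using (List; length; filter; allFin; concatMap; map)
open import Data.Product using (Σ; _×_; _,_; ∃)
open import Relation.Nullary using (yes; no; ¬_)
open import Relation.Binary.PropositionalEquality using (_≡_)
open import Relation.Binary.Construct.Closure.ReflexiveTransitive using (Star)
open import Function.Bundles using (_⇔_)

-- A permutation of {1,…,n} (0-indexed as Fin n) in one-line notation:
-- the entry at position i is the image of i.
Perm : ℕ → Set
Perm n = Vec (Fin n) n

app : ∀ {n} → Perm n → Fin n → Fin n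
app = lookup

_·_ : ∀ {n} → Perm n → Perm n → Perm n
x · y = tabulate (λ i → app x (app y i))

swap : ∀ {n} → Fin n → Fin n → Perm n
swap a b = tabulate f
  where
  f : _ → _
  f i with i ≟ᶠ a
  ... | yes _ = b
  ... | no _ with i ≟ᶠ b
  ...   | yes _ = a
  ...   | no _ = i

identity : ∀ {n} → Perm n
identity = tabulate (λ i → i)

-- simple reflection s_i = (i, i+1) in S_n (1-indexed i, 1 ≤ i ≤ n-1);
-- 0-indexed it swaps positions i-1 and i.  (Identity for i out of range;
-- never used there.)
s : (n i : ℕ) → Perm n
s n i with i ∸ 1 <? n | i <? n
... | yes h₁ | yes h₂ = swap (fromℕ< h₁) (fromℕ< h₂)
... | _      | _      = identity

ℓ : ∀ {n} → Perm n → ℕ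
ℓ {n} z = length (filter (λ ij → inv? ij) pairs)
  where
  pairs : List (Fin n × Fin n)
  pairs = concatMap (λ i → map (λ j → i , j) (allFin n)) (allFin n)
  inv? : (ij : Fin n × Fin n) → _
  inv? (i , j) with toℕ i <? toℕ j | toℕ (app z j) <? toℕ (app z i)
  ... | yes p | yes q = yes (p , q)
  ... | no ¬p | _     = no (λ { (p , _) → ¬p p })
  ... | yes _ | no ¬q = no (λ { (_ , q) → ¬q q })

IsFPFInv : ∀ {n} → Perm n → Set
IsFPFInv z = ∀ i → (app z (app z i) ≡ i) × ¬ (app z i ≡ i)

BruhatStep : ∀ {n} → Perm n → Perm n → Set
BruhatStep {n} z z' = Σ (Fin n) λ a → Σ (Fin n) λ b →
  (a <ᶠ b) × (z' ≡ (swap a b · z) · swap a b) × (ℓ z ≤ ℓ z')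

_≤B_ : ∀ {n} → Perm n → Perm n → Set
_≤B_ = Star BruhatStep

InTau : ∀ {n} → ℕ → Perm n → Set
InTau {n} i z = ((s n i · z) · s n i) ≤B z

double : ℕ → ℕ
double zero = zero
double (suc k) = suc (suc (double k))

IsW : (p : ℕ) → Perm (double p) → Set
IsW p w = IsFPFInv w ×
  (∀ i → 1 ≤ i → i < double p → (InTau i w ⇔ (i ≡ p)))

w₀ : ∀ {n} → Perm n
w₀ = tabulate opposite

embed : ∀ {m} → Perm m → Perm (suc (suc m))
embed {m} z = tabulate f
  where
  f : Fin (suc (suc m)) → Fin (suc (suc m))
  f i with toℕ i <? m
  ... | yes h = inject₁ (inject₁ (app z (fromℕ< h)))
  ... | no _ = i

ρ : ∀ {m} → Perm m → Perm (suc (suc m))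
ρ {m} z = ((w₀ · embed z) · s (suc (suc m)) (suc m)) · w₀

σ : (n p : ℕ) → Perm n
σ n zero = identity
σ n (suc p) = s n (suc p) · σ n p

σ⁻¹ : (n p : ℕ) → Perm n
σ⁻¹ n zero = identity
σ⁻¹ n (suc p) = σ⁻¹ n p · s n (suc p)

ν : (n p : ℕ) → Perm n → Perm n
ν n p x = (σ n p · x) · σ⁻¹ n p

{-# OPTIONS --safe #-}
module Submission where

-- For a fixed-point-free involution z, s = s_{k+1} lies in τ(z) exactly when k is a descent
-- of z, i.e. z(k+1) < z(k).  Reindexing the inversions of szs by s, each of them comes from an
-- inversion of z, and at a descent the inversion (k, k+1) of z is lost.  So at a descent either
-- szs = z or z lies one Bruhat step above szs, while at an ascent the same count applied to szs
-- gives ℓ(z) < ℓ(szs), which szs ≤ z forbids.  A fixed-point-free involution of {0, …, 2p−1}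
-- whose only descent is at p − 1 is increasing on [0, p) and maps it into [p, 2p), hence it is
-- i ↦ i + p mod 2p; conversely this map has τ = {s_p}.  The recursion is then checked by
-- evaluating ν_p(ρ_n(w_{n−2})) at every point.

open import Defs
open import Data.Fin as Fin using (Fin; toℕ; fromℕ<; opposite)
open import Data.Fin.Permutation using (permutation)
open import Data.Fin.Properties
  using (toℕ-inject₁; toℕ-fromℕ<; toℕ<n; fromℕ<-toℕ; toℕ-injective; opposite-prop)
open import Data.List as List using (List; length; filter; concatMap)
open import Data.List.Properties using (length-++; filter-++)
open import Data.Nat
open import Data.Nat.Properties
open import Algebra.Properties.CommutativeMonoid.Sum +-0-commutativeMonoid
  using (sum; sum-syntax; sum-cong-≗; sum-permute)
open import Data.Nat.Tactic.RingSolver using (solve-∀)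
open import Data.Product using (_×_; _,_; proj₁; proj₂; ∃!)
open import Data.Sum using (_⊎_; inj₁; inj₂)
open import Data.Vec using (tabulate; lookup)
open import Data.Vec.Properties using (lookup∘tabulate; tabulate∘lookup; tabulate-cong)
open import Function using (_∘_; id)
open import Function.Bundles using (_⇔_; mk⇔; Equivalence)
open import Function.Construct.Composition using (_⇔-∘_)
open import Level using (0ℓ)
open import Relation.Binary.Construct.Closure.ReflexiveTransitive using (ε; _◅_)
open import Relation.Binary.Definitions using (tri<; tri≈; tri>)
open import Relation.Binary.PropositionalEquality
open import Relation.Nullary
open import Relation.Nullary.Decidable using (_×-dec_)
open import Relation.Unary using (Pred; Decidable)

involution-injective : ∀ {A : Set} {f : A → A} → f ∘ f ≗ id → ∀ {x y} → f x ≡ f y → x ≡ y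
involution-injective {f = f} f-involutive {x} {y} fx≡fy =
  trans (sym (f-involutive x)) (trans (cong f fx≡fy) (f-involutive y))

-- Extending a permutation by the identity beyond n makes ⟨ x · y ⟩ = ⟨ x ⟩ ∘ ⟨ y ⟩ hold on all of ℕ.
⟨_⟩ : ∀ {n} → Perm n → ℕ → ℕ
⟨_⟩ {n} z i with i <? n
... | yes i<n = toℕ (app z (fromℕ< i<n))
... | no  _   = i

⟨⟩-< : ∀ {n} (z : Perm n) {i} (i<n : i < n) → ⟨ z ⟩ i ≡ toℕ (app z (fromℕ< i<n))
⟨⟩-< {n} z {i} i<n with i <? n
... | yes _   = refl
... | no  i≮n = contradiction i<n i≮n

⟨⟩-≥ : ∀ {n} (z : Perm n) {i} → n ≤ i → ⟨ z ⟩ i ≡ i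
⟨⟩-≥ {n} z {i} n≤i with i <? n
... | yes i<n = contradiction n≤i (<⇒≱ i<n)
... | no  _   = refl

⟨⟩-toℕ : ∀ {n} (z : Perm n) (i : Fin n) → ⟨ z ⟩ (toℕ i) ≡ toℕ (app z i)
⟨⟩-toℕ z i = trans (⟨⟩-< z (toℕ<n i)) (cong (toℕ ∘ app z) (fromℕ<-toℕ i (toℕ<n i)))

⟨⟩-bounded : ∀ {n} (z : Perm n) {i} → i < n → ⟨ z ⟩ i < n
⟨⟩-bounded z i<n = subst (_< _) (sym (⟨⟩-< z i<n)) (toℕ<n _)

⟨⟩-≗ : ∀ {n} {z : Perm n} {g : ℕ → ℕ} →
       (∀ i → toℕ (app z i) ≡ g (toℕ i)) → (∀ i → n ≤ i → g i ≡ i) → ⟨ z ⟩ ≗ g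
⟨⟩-≗ {n} {z} {g} inside outside i with i <? n
... | yes i<n = trans (inside (fromℕ< i<n)) (cong g (toℕ-fromℕ< i<n))
... | no  i≮n = sym (outside i (≮⇒≥ i≮n))

⟨⟩-ext : ∀ {n} {x y : Perm n} → (∀ i → i < n → ⟨ x ⟩ i ≡ ⟨ y ⟩ i) → x ≡ y
⟨⟩-ext {x = x} {y} x≗y = begin
  x                    ≡⟨ tabulate∘lookup x ⟨
  tabulate (lookup x)  ≡⟨ tabulate-cong (λ i → toℕ-injective (begin
    toℕ (app x i)        ≡⟨ ⟨⟩-toℕ x i ⟨
    ⟨ x ⟩ (toℕ i)        ≡⟨ x≗y (toℕ i) (toℕ<n i) ⟩
    ⟨ y ⟩ (toℕ i)        ≡⟨ ⟨⟩-toℕ y i ⟩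
    toℕ (app y i)        ∎)) ⟩
  tabulate (lookup y)  ≡⟨ tabulate∘lookup y ⟩
  y                    ∎
  where open ≡-Reasoning

⟨⟩-involutive : ∀ {n} {z : Perm n} → app z ∘ app z ≗ id → ⟨ z ⟩ ∘ ⟨ z ⟩ ≗ id
⟨⟩-involutive {n} {z} z-involutive x with x <? n
... | yes x<n = trans (⟨⟩-toℕ z _) (trans (cong toℕ (z-involutive _)) (toℕ-fromℕ< x<n))
... | no  x≮n = ⟨⟩-≥ z (≮⇒≥ x≮n)

⟨⟩-no-fixed-point : ∀ {n} {z : Perm n} → IsFPFInv z → ∀ {x} → x < n → ⟨ z ⟩ x ≢ x
⟨⟩-no-fixed-point {z = z} fpf x<n zx≡x =
  proj₂ (fpf (fromℕ< x<n)) (toℕ-injective (trans (sym (⟨⟩-< z x<n)) (trans zx≡x (sym (toℕ-fromℕ< x<n)))))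

⟨·⟩ : ∀ {n} (x y : Perm n) i → ⟨ x · y ⟩ i ≡ ⟨ x ⟩ (⟨ y ⟩ i)
⟨·⟩ {n} x y i with i <? n
... | yes i<n = trans (cong toℕ (lookup∘tabulate _ (fromℕ< i<n))) (sym (⟨⟩-toℕ x _))
... | no  i≮n = sym (⟨⟩-≥ x (≮⇒≥ i≮n))

⟨identity⟩ : ∀ {n} → ⟨ identity {n} ⟩ ≗ id
⟨identity⟩ {n} = ⟨⟩-≗ {z = identity {n}} (λ i → cong toℕ (lookup∘tabulate id i)) (λ _ _ → refl)

⟨w₀⟩ : ∀ {n} {i} → i < n → ⟨ w₀ {n} ⟩ i ≡ n ∸ suc i
⟨w₀⟩ {n} {i} i<n = begin
  ⟨ w₀ {n} ⟩ i                ≡⟨ ⟨⟩-< (w₀ {n}) i<n ⟩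
  toℕ (app w₀ (fromℕ< i<n))   ≡⟨ cong toℕ (lookup∘tabulate opposite _) ⟩
  toℕ (opposite (fromℕ< i<n)) ≡⟨ opposite-prop _ ⟩
  n ∸ suc (toℕ (fromℕ< i<n))  ≡⟨ cong (λ j → n ∸ suc j) (toℕ-fromℕ< i<n) ⟩
  n ∸ suc i                   ∎
  where open ≡-Reasoning

-- sᴺ k is the action of s_{k+1} on ℕ (positions are 0-indexed).
sᴺ : ℕ → ℕ → ℕ
sᴺ zero    zero          = 1
sᴺ zero    (suc zero)    = 0
sᴺ zero    (suc (suc x)) = suc (suc x)
sᴺ (suc k) zero          = zero
sᴺ (suc k) (suc x)       = suc (sᴺ k x)

sᴺ-involutive : ∀ k → sᴺ k ∘ sᴺ k ≗ id
sᴺ-involutive zero    zero          = refl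
sᴺ-involutive zero    (suc zero)    = refl
sᴺ-involutive zero    (suc (suc x)) = refl
sᴺ-involutive (suc k) zero          = refl
sᴺ-involutive (suc k) (suc x)       = cong suc (sᴺ-involutive k x)

sᴺ-left : ∀ k → sᴺ k k ≡ suc k
sᴺ-left zero    = refl
sᴺ-left (suc k) = cong suc (sᴺ-left k)

sᴺ-right : ∀ k → sᴺ k (suc k) ≡ k
sᴺ-right zero    = refl
sᴺ-right (suc k) = cong suc (sᴺ-right k)

sᴺ-fixes : ∀ k {x} → x ≢ k → x ≢ suc k → sᴺ k x ≡ x
sᴺ-fixes zero    {zero}        x≢k _     = contradiction refl x≢k
sᴺ-fixes zero    {suc zero}    _   x≢1+k = contradiction refl x≢1+k
sᴺ-fixes zero    {suc (suc x)} _   _     = refl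
sᴺ-fixes (suc k) {zero}        _   _     = refl
sᴺ-fixes (suc k) {suc x}       x≢k x≢1+k = cong suc (sᴺ-fixes k (x≢k ∘ cong suc) (x≢1+k ∘ cong suc))

sᴺ-below : ∀ k {x} → x < k → sᴺ k x ≡ x
sᴺ-below k x<k = sᴺ-fixes k (<⇒≢ x<k) (<⇒≢ (m<n⇒m<1+n x<k))

sᴺ-above : ∀ k {x} → suc k < x → sᴺ k x ≡ x
sᴺ-above k 1+k<x = sᴺ-fixes k (>⇒≢ (<-trans (n<1+n k) 1+k<x)) (>⇒≢ 1+k<x)

sᴺ-injective : ∀ k {x y} → sᴺ k x ≡ sᴺ k y → x ≡ y
sᴺ-injective k = involution-injective (sᴺ-involutive k)

sᴺ-mono-< : ∀ k {u v} → u < v → ¬ (u ≡ k × v ≡ suc k) → sᴺ k u < sᴺ k v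
sᴺ-mono-< zero    {zero}        {suc zero}    _         ¬k,1+k = contradiction (refl , refl) ¬k,1+k
sᴺ-mono-< zero    {zero}        {suc (suc v)} _         _      = s≤s (s≤s z≤n)
sᴺ-mono-< zero    {suc zero}    {suc (suc v)} _         _      = s≤s z≤n
sᴺ-mono-< zero    {suc (suc u)} {suc (suc v)} u<v       _      = u<v
sᴺ-mono-< zero    {suc zero}    {suc zero}    (s≤s ())  _
sᴺ-mono-< zero    {suc (suc u)} {suc zero}    (s≤s ())  _
sᴺ-mono-< (suc k) {zero}        {suc v}       _         _      = s≤s z≤n
sᴺ-mono-< (suc k) {suc u}       {suc v}       (s≤s u<v) ¬k,1+k =
  s≤s (sᴺ-mono-< k u<v (λ (u≡k , v≡1+k) → ¬k,1+k (cong suc u≡k , cong suc v≡1+k)))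

sᴺ-reflects-< : ∀ k {u v} → sᴺ k u < sᴺ k v → u < v ⊎ (u ≡ suc k × v ≡ k)
sᴺ-reflects-< k {u} {v} su<sv with sᴺ k u ≟ k | sᴺ k v ≟ suc k
... | yes su≡k | yes sv≡1+k = inj₂ (sᴺ-injective k (trans su≡k (sym (sᴺ-right k))) ,
                                    sᴺ-injective k (trans sv≡1+k (sym (sᴺ-left k))))
... | no  su≢k | _          = inj₁ (subst₂ _<_ (sᴺ-involutive k u) (sᴺ-involutive k v)
                                      (sᴺ-mono-< k su<sv (su≢k ∘ proj₁)))
... | yes _    | no sv≢1+k  = inj₁ (subst₂ _<_ (sᴺ-involutive k u) (sᴺ-involutive k v)
                                      (sᴺ-mono-< k su<sv (sv≢1+k ∘ proj₂)))

sᴺ-conj-swapped : ∀ {f : ℕ → ℕ} → f ∘ f ≗ id → ∀ {k} → f k ≡ suc k → sᴺ k ∘ f ∘ sᴺ k ≗ f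
sᴺ-conj-swapped {f} f-involutive {k} fk≡1+k x with x ≟ k | x ≟ suc k
... | yes refl | _ = begin
  sᴺ k (f (sᴺ k k))  ≡⟨ cong (sᴺ k ∘ f) (sᴺ-left k) ⟩
  sᴺ k (f (suc k))   ≡⟨ cong (sᴺ k ∘ f) fk≡1+k ⟨
  sᴺ k (f (f k))     ≡⟨ cong (sᴺ k) (f-involutive k) ⟩
  sᴺ k k             ≡⟨ sᴺ-left k ⟩
  suc k              ≡⟨ fk≡1+k ⟨
  f k                ∎
  where open ≡-Reasoning
... | no _ | yes refl = begin
  sᴺ k (f (sᴺ k (suc k)))  ≡⟨ cong (sᴺ k ∘ f) (sᴺ-right k) ⟩
  sᴺ k (f k)               ≡⟨ cong (sᴺ k) fk≡1+k ⟩
  sᴺ k (suc k)             ≡⟨ sᴺ-right k ⟩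
  k                        ≡⟨ f-involutive k ⟨
  f (f k)                  ≡⟨ cong f fk≡1+k ⟩
  f (suc k)                ∎
  where open ≡-Reasoning
... | no x≢k | no x≢1+k = trans (cong (sᴺ k ∘ f) (sᴺ-fixes k x≢k x≢1+k)) (sᴺ-fixes k fx≢k fx≢1+k)
  where
  f-injective : ∀ {x y} → f x ≡ f y → x ≡ y
  f-injective = involution-injective f-involutive
  fx≢k : f x ≢ k
  fx≢k fx≡k = x≢1+k (f-injective (trans fx≡k (trans (sym (f-involutive k)) (cong f fk≡1+k))))
  fx≢1+k : f x ≢ suc k
  fx≢1+k fx≡1+k = x≢k (f-injective (trans fx≡1+k (sym fk≡1+k)))

-- `swap` and `embed` are tabulated from where-bound with-functions of Defs, which cannot be
-- named here: the hole in each `…-entry` lemma stands for such a value and is solved by its use.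
mutual
  swap-toℕ : ∀ {n k} {a b : Fin n} → toℕ a ≡ k → toℕ b ≡ suc k →
             ∀ x → toℕ (app (swap a b) x) ≡ sᴺ k (toℕ x)
  swap-toℕ a≡k b≡1+k x = trans (cong toℕ (lookup∘tabulate _ x)) (swap-entry a≡k b≡1+k x)

  swap-entry : ∀ {n k} {a b : Fin n} → toℕ a ≡ k → toℕ b ≡ suc k → ∀ x → toℕ _ ≡ sᴺ k (toℕ x)
  swap-entry {k = k} {a} {b} a≡k b≡1+k x with x Fin.≟ a
  ... | yes refl = trans b≡1+k (trans (sym (sᴺ-left k)) (cong (sᴺ k) (sym a≡k)))
  ... | no  x≢a with x Fin.≟ b
  ...   | yes refl = trans a≡k (trans (sym (sᴺ-right k)) (cong (sᴺ k) (sym b≡1+k)))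
  ...   | no  x≢b  = sym (sᴺ-fixes k (λ x≡k → x≢a (toℕ-injective (trans x≡k (sym a≡k))))
                                     (λ x≡1+k → x≢b (toℕ-injective (trans x≡1+k (sym b≡1+k)))))

mutual
  embed-toℕ : ∀ {m} (z : Perm m) (j : Fin (suc (suc m))) → toℕ (app (embed z) j) ≡ ⟨ z ⟩ (toℕ j)
  embed-toℕ {m} z Fin.zero with 0 <? m
  ... | yes _ = trans (toℕ-inject₁ _) (toℕ-inject₁ _)
  ... | no  _ = refl
  embed-toℕ {m} z (Fin.suc Fin.zero) with 1 <? m
  ... | yes _ = trans (toℕ-inject₁ _) (toℕ-inject₁ _)
  ... | no  _ = refl
  embed-toℕ z (Fin.suc (Fin.suc x)) = trans (cong toℕ (lookup∘tabulate _ x)) (embed-entry z x)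

  embed-entry : ∀ {m} (z : Perm m) (x : Fin m) → toℕ _ ≡ ⟨ z ⟩ (suc (suc (toℕ x)))
  embed-entry {m} z x with suc (suc (toℕ x)) <? m
  ... | yes _ = trans (toℕ-inject₁ _) (toℕ-inject₁ _)
  ... | no  _ = refl

⟨swap⟩ : ∀ {n k} {a b : Fin n} → toℕ a ≡ k → toℕ b ≡ suc k → ⟨ swap a b ⟩ ≗ sᴺ k
⟨swap⟩ {n} {k} {b = b} a≡k b≡1+k =
  ⟨⟩-≗ (swap-toℕ a≡k b≡1+k) (λ x n≤x → sᴺ-above k (<-≤-trans (subst (_< n) b≡1+k (toℕ<n b)) n≤x))

⟨s⟩ : ∀ {n k} → suc k < n → ⟨ s n (suc k) ⟩ ≗ sᴺ k
⟨s⟩ {n} {k} 1+k<n with k <? n | suc k <? n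
... | yes k<n | yes _    = ⟨swap⟩ (toℕ-fromℕ< k<n) (toℕ-fromℕ< 1+k<n)
... | no  k≮n | _        = contradiction (<-trans (n<1+n k) 1+k<n) k≮n
... | yes _   | no 1+k≮n = contradiction 1+k<n 1+k≮n

⟨embed⟩ : ∀ {m} (z : Perm m) → ⟨ embed z ⟩ ≗ ⟨ z ⟩
⟨embed⟩ {m} z = ⟨⟩-≗ {g = ⟨ z ⟩} (embed-toℕ z) (λ i 2+m≤i → ⟨⟩-≥ z (≤-trans (m≤n+m m 2) 2+m≤i))

𝟙 : {A : Set} → Dec A → ℕ
𝟙 (yes _) = 1
𝟙 (no  _) = 0

𝟙-mono : {A B : Set} → (A → B) → (a? : Dec A) (b? : Dec B) → 𝟙 a? ≤ 𝟙 b?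
𝟙-mono _   (no  _) _       = z≤n
𝟙-mono _   (yes _) (yes _) = ≤-refl
𝟙-mono A→B (yes a) (no ¬b) = contradiction (A→B a) ¬b

𝟙-cong : {A B : Set} → (A → B) → (B → A) → (a? : Dec A) (b? : Dec B) → 𝟙 a? ≡ 𝟙 b?
𝟙-cong A→B B→A a? b? = ≤-antisym (𝟙-mono A→B a? b?) (𝟙-mono B→A b? a?)

𝟙-< : {A B : Set} → ¬ A → B → (a? : Dec A) (b? : Dec B) → 𝟙 a? < 𝟙 b?
𝟙-< ¬a _ (yes a) _       = contradiction a ¬a
𝟙-< _  _ (no _)  (yes _) = s≤s z≤n
𝟙-< _  b (no _)  (no ¬b) = contradiction b ¬b

sum-mono-≤ : ∀ {n} {f g : Fin n → ℕ} → (∀ i → f i ≤ g i) → sum f ≤ sum g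
sum-mono-≤ {zero}  _   = z≤n
sum-mono-≤ {suc n} f≤g = +-mono-≤ (f≤g Fin.zero) (sum-mono-≤ (f≤g ∘ Fin.suc))

sum-mono-< : ∀ {n} {f g : Fin n → ℕ} → (∀ i → f i ≤ g i) → ∀ i → f i < g i → sum f < sum g
sum-mono-< f≤g Fin.zero    fi<gi = +-mono-<-≤ fi<gi (sum-mono-≤ (f≤g ∘ Fin.suc))
sum-mono-< f≤g (Fin.suc i) fi<gi = +-mono-≤-< (f≤g Fin.zero) (sum-mono-< (f≤g ∘ Fin.suc) i fi<gi)

sum-sᴺ-invariant : ∀ {n k} → suc k < n → (g : ℕ → ℕ) →
                   ∑[ i < n ] g (toℕ i) ≡ ∑[ i < n ] g (sᴺ k (toℕ i))
sum-sᴺ-invariant {n} {k} 1+k<n g =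
  trans (sum-permute (g ∘ toℕ) (permutation (app S) (app S) S-involutive S-involutive))
        (sum-cong-≗ (cong g ∘ S-toℕ))
  where
  S : Perm n
  S = s n (suc k)
  S-toℕ : ∀ i → toℕ (app S i) ≡ sᴺ k (toℕ i)
  S-toℕ i = trans (sym (⟨⟩-toℕ S i)) (⟨s⟩ 1+k<n (toℕ i))
  S-involutive : app S ∘ app S ≗ id
  S-involutive i = toℕ-injective (trans (S-toℕ _) (trans (cong (sᴺ k) (S-toℕ i)) (sᴺ-involutive k _)))

module _ {A : Set} {P : Pred A 0ℓ} (P? : Decidable P) where

  count-concatMap : ∀ {B : Set} {n} (f : B → List A) (g : Fin n → B) →
    length (filter P? (concatMap f (List.tabulate g))) ≡ ∑[ i < n ] length (filter P? (f (g i)))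
  count-concatMap {n = zero}  f g = refl
  count-concatMap {n = suc n} f g =
    trans (cong length (filter-++ P? (f (g Fin.zero)) _))
          (trans (length-++ (filter P? (f (g Fin.zero))))
                 (cong (length (filter P? (f (g Fin.zero))) +_) (count-concatMap f (g ∘ Fin.suc))))

  count-map : ∀ {B : Set} {n} (h : B → A) (g : Fin n → B) →
    length (filter P? (List.map h (List.tabulate g))) ≡ ∑[ i < n ] 𝟙 (P? (h (g i)))
  count-map {n = zero}  h g = refl
  count-map {n = suc n} h g with P? (h (g Fin.zero))
  ... | yes _ = cong suc (count-map h (g ∘ Fin.suc))
  ... | no  _ = count-map h (g ∘ Fin.suc)

Inversion : (ℕ → ℕ) → ℕ → ℕ → Set
Inversion f i j = i < j × f j < f i

inversion? : ∀ f i j → Dec (Inversion f i j)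
inversion? f i j = (i <? j) ×-dec (f j <? f i)

inversions : ℕ → (ℕ → ℕ) → ℕ
inversions n f = ∑[ i < n ] ∑[ j < n ] 𝟙 (inversion? f (toℕ i) (toℕ j))

inversions-cong : ∀ n {f g} → f ≗ g → inversions n f ≡ inversions n g
inversions-cong n f≗g =
  sum-cong-≗ {n} λ i → sum-cong-≗ {n} λ j → 𝟙-cong (along f≗g) (along (sym ∘ f≗g)) _ _
  where
  along : ∀ {f g i j} → f ≗ g → Inversion f i j → Inversion g i j
  along {i = i} {j} f≗g (i<j , fj<fi) = i<j , subst₂ _<_ (f≗g j) (f≗g i) fj<fi

ℓ≡inversions : ∀ {n} (z : Perm n) → ℓ z ≡ inversions n ⟨ z ⟩
ℓ≡inversions {n} z =
  trans (count-concatMap _ {n = n} (λ i → List.map (i ,_) (List.allFin n)) id)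
        (sum-cong-≗ {n} λ i → trans (count-map _ {n = n} (i ,_) id)
                                    (sum-cong-≗ {n} λ j → 𝟙-cong (to i j) (from i j) _ _))
  where
  to : ∀ i j → toℕ i < toℕ j × toℕ (app z j) < toℕ (app z i) → Inversion ⟨ z ⟩ (toℕ i) (toℕ j)
  to i j (i<j , zj<zi) = i<j , subst₂ _<_ (sym (⟨⟩-toℕ z j)) (sym (⟨⟩-toℕ z i)) zj<zi
  from : ∀ i j → Inversion ⟨ z ⟩ (toℕ i) (toℕ j) → toℕ i < toℕ j × toℕ (app z j) < toℕ (app z i)
  from i j (i<j , zj<zi) = i<j , subst₂ _<_ (⟨⟩-toℕ z j) (⟨⟩-toℕ z i) zj<zi

module _ {f : ℕ → ℕ} (f-involutive : f ∘ f ≗ id) {k : ℕ}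
         (descent : f (suc k) < f k) (f[k]≢1+k : f k ≢ suc k) where

  conj-inversion : ∀ {i j} → Inversion (sᴺ k ∘ f ∘ sᴺ k) (sᴺ k i) (sᴺ k j) → Inversion f i j
  conj-inversion {i} {j} (si<sj , f′sj<f′si) = i<j , fj<fi
    where
    sfj<sfi : sᴺ k (f j) < sᴺ k (f i)
    sfj<sfi = subst₂ (λ x y → sᴺ k (f x) < sᴺ k (f y)) (sᴺ-involutive k j) (sᴺ-involutive k i) f′sj<f′si
    ¬ascent : ¬ (sᴺ k (f k) < sᴺ k (f (suc k)))
    ¬ascent sfk<sf1+k with sᴺ-reflects-< k sfk<sf1+k
    ... | inj₁ fk<f1+k      = <-asym descent fk<f1+k
    ... | inj₂ (fk≡1+k , _) = f[k]≢1+k fk≡1+k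
    i<j : i < j
    i<j with sᴺ-reflects-< k si<sj
    ... | inj₁ i<j           = i<j
    ... | inj₂ (i≡1+k , j≡k) =
      contradiction (subst₂ (λ x y → sᴺ k (f x) < sᴺ k (f y)) j≡k i≡1+k sfj<sfi) ¬ascent
    fj<fi : f j < f i
    fj<fi with sᴺ-reflects-< k sfj<sfi
    ... | inj₁ fj<fi           = fj<fi
    ... | inj₂ (fj≡1+k , fi≡k) =
      contradiction (subst₂ _<_ (trans (sym (f-involutive i)) (cong f fi≡k))
                                (trans (sym (f-involutive j)) (cong f fj≡1+k)) i<j)
                    (<-asym descent)

  inversions-conj-< : ∀ {n} → suc k < n → inversions n (sᴺ k ∘ f ∘ sᴺ k) < inversions n f
  inversions-conj-< {n} 1+k<n = begin-strict
    inversions n f′                                                        ≡⟨ reindex ⟩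
    ∑[ i < n ] ∑[ j < n ] 𝟙 (inversion? f′ (sᴺ k (toℕ i)) (sᴺ k (toℕ j)))  <⟨ termwise ⟩
    inversions n f                                                         ∎
    where
    open ≤-Reasoning
    f′ : ℕ → ℕ
    f′ = sᴺ k ∘ f ∘ sᴺ k
    reindex : inversions n f′ ≡ ∑[ i < n ] ∑[ j < n ] 𝟙 (inversion? f′ (sᴺ k (toℕ i)) (sᴺ k (toℕ j)))
    reindex = trans (sum-sᴺ-invariant 1+k<n (λ i → ∑[ j < n ] 𝟙 (inversion? f′ i (toℕ j))))
                    (sum-cong-≗ {n} λ i → sum-sᴺ-invariant 1+k<n (𝟙 ∘ inversion? f′ (sᴺ k (toℕ i))))
    pointwise : ∀ i j → 𝟙 (inversion? f′ (sᴺ k i) (sᴺ k j)) ≤ 𝟙 (inversion? f i j)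
    pointwise i j = 𝟙-mono conj-inversion _ _
    at-k : 𝟙 (inversion? f′ (sᴺ k k) (sᴺ k (suc k))) < 𝟙 (inversion? f k (suc k))
    at-k = 𝟙-< (λ (sk<s1+k , _) → <-asym (subst₂ _<_ (sᴺ-left k) (sᴺ-right k) sk<s1+k) (n<1+n k))
               (n<1+n k , descent) _ _
    k<n : k < n
    k<n = <-trans (n<1+n k) 1+k<n
    at-ab : 𝟙 (inversion? f′ (sᴺ k (toℕ (fromℕ< k<n))) (sᴺ k (toℕ (fromℕ< 1+k<n))))
          < 𝟙 (inversion? f (toℕ (fromℕ< k<n)) (toℕ (fromℕ< 1+k<n)))
    at-ab = subst₂ (λ a b → 𝟙 (inversion? f′ (sᴺ k a) (sᴺ k b)) < 𝟙 (inversion? f a b))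
                   (sym (toℕ-fromℕ< k<n)) (sym (toℕ-fromℕ< 1+k<n)) at-k
    termwise : ∑[ i < n ] ∑[ j < n ] 𝟙 (inversion? f′ (sᴺ k (toℕ i)) (sᴺ k (toℕ j))) < inversions n f
    termwise = sum-mono-< (λ i → sum-mono-≤ {n} (pointwise (toℕ i) ∘ toℕ)) (fromℕ< k<n)
                          (sum-mono-< {n} (pointwise (toℕ (fromℕ< k<n)) ∘ toℕ) (fromℕ< 1+k<n) at-ab)

≤B⇒ℓ≤ : ∀ {n} {x y : Perm n} → x ≤B y → ℓ x ≤ ℓ y
≤B⇒ℓ≤ ε                                = ≤-refl
≤B⇒ℓ≤ ((_ , _ , _ , _ , ℓx≤ℓx′) ◅ x′≤y) = ≤-trans ℓx≤ℓx′ (≤B⇒ℓ≤ x′≤y)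

module _ {n k : ℕ} (1+k<n : suc k < n) {z : Perm n} (z-involutive : app z ∘ app z ≗ id) where

  private
    S : Perm n
    S = s n (suc k)
    Z : ℕ → ℕ
    Z = ⟨ z ⟩
    Z-involutive : Z ∘ Z ≗ id
    Z-involutive = ⟨⟩-involutive z-involutive

  ⟨SzS⟩ : ⟨ (S · z) · S ⟩ ≗ sᴺ k ∘ Z ∘ sᴺ k
  ⟨SzS⟩ x = trans (⟨·⟩ (S · z) S x)
                  (trans (⟨·⟩ S z _) (trans (⟨s⟩ 1+k<n _) (cong (sᴺ k ∘ Z) (⟨s⟩ 1+k<n x))))

  ℓ-SzS : ℓ ((S · z) · S) ≡ inversions n (sᴺ k ∘ Z ∘ sᴺ k)
  ℓ-SzS = trans (ℓ≡inversions ((S · z) · S)) (inversions-cong n ⟨SzS⟩)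

  descent⇒InTau : Z (suc k) < Z k → InTau (suc k) z
  descent⇒InTau desc with Z k ≟ suc k
  ... | yes Zk≡1+k = subst (_≤B z) (sym SzS≡z) ε
    where
    SzS≡z : (S · z) · S ≡ z
    SzS≡z = ⟨⟩-ext λ x _ → trans (⟨SzS⟩ x) (sᴺ-conj-swapped Z-involutive Zk≡1+k x)
  ... | no  Zk≢1+k = (a , b , a<b , z≡tSzSt , ℓSzS≤ℓz) ◅ ε
    where
    k<n : k < n
    k<n = <-trans (n<1+n k) 1+k<n
    a b : Fin n
    a = fromℕ< k<n
    b = fromℕ< 1+k<n
    a<b : a Fin.< b
    a<b = subst₂ _<_ (sym (toℕ-fromℕ< k<n)) (sym (toℕ-fromℕ< 1+k<n)) (n<1+n k)
    t≗sᴺ : ⟨ swap a b ⟩ ≗ sᴺ k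
    t≗sᴺ = ⟨swap⟩ (toℕ-fromℕ< k<n) (toℕ-fromℕ< 1+k<n)
    z≡tSzSt : z ≡ (swap a b · ((S · z) · S)) · swap a b
    z≡tSzSt = ⟨⟩-ext λ x _ → sym (begin
      ⟨ (swap a b · ((S · z) · S)) · swap a b ⟩ x      ≡⟨ ⟨·⟩ (swap a b · ((S · z) · S)) (swap a b) x ⟩
      ⟨ swap a b · ((S · z) · S) ⟩ (⟨ swap a b ⟩ x)    ≡⟨ ⟨·⟩ (swap a b) ((S · z) · S) _ ⟩
      ⟨ swap a b ⟩ (⟨ (S · z) · S ⟩ (⟨ swap a b ⟩ x))  ≡⟨ t≗sᴺ _ ⟩
      sᴺ k (⟨ (S · z) · S ⟩ (⟨ swap a b ⟩ x))          ≡⟨ cong (sᴺ k ∘ ⟨ (S · z) · S ⟩) (t≗sᴺ x) ⟩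
      sᴺ k (⟨ (S · z) · S ⟩ (sᴺ k x))                  ≡⟨ cong (sᴺ k) (⟨SzS⟩ (sᴺ k x)) ⟩
      sᴺ k (sᴺ k (Z (sᴺ k (sᴺ k x))))                  ≡⟨ sᴺ-involutive k _ ⟩
      Z (sᴺ k (sᴺ k x))                                ≡⟨ cong Z (sᴺ-involutive k x) ⟩
      Z x                                              ∎)
      where open ≡-Reasoning
    ℓSzS≤ℓz : ℓ ((S · z) · S) ≤ ℓ z
    ℓSzS≤ℓz = begin
      ℓ ((S · z) · S)                  ≡⟨ ℓ-SzS ⟩
      inversions n (sᴺ k ∘ Z ∘ sᴺ k)  ≤⟨ <⇒≤ (inversions-conj-< {f = Z} Z-involutive desc Zk≢1+k 1+k<n) ⟩
      inversions n Z                   ≡⟨ ℓ≡inversions z ⟨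
      ℓ z                              ∎
      where open ≤-Reasoning

  InTau⇒descent : Z k ≢ k → InTau (suc k) z → Z (suc k) < Z k
  InTau⇒descent Zk≢k SzS≤z with <-cmp (Z (suc k)) (Z k)
  ... | tri< desc _ _    = desc
  ... | tri≈ _ Z1+k≡Zk _ = contradiction (involution-injective {f = Z} Z-involutive Z1+k≡Zk) 1+n≢n
  ... | tri> _ _ asc     = contradiction (≤B⇒ℓ≤ SzS≤z) (<⇒≱ ℓz<ℓSzS)
    where
    Z′ : ℕ → ℕ
    Z′ = sᴺ k ∘ Z ∘ sᴺ k
    Z′-involutive : Z′ ∘ Z′ ≗ id
    Z′-involutive x = trans (cong (sᴺ k ∘ Z) (sᴺ-involutive k _))
                            (trans (cong (sᴺ k) (Z-involutive _)) (sᴺ-involutive k x))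
    Z′-descent : Z′ (suc k) < Z′ k
    Z′-descent = subst₂ (λ x y → sᴺ k (Z x) < sᴺ k (Z y)) (sym (sᴺ-right k)) (sym (sᴺ-left k))
                        (sᴺ-mono-< k asc (Zk≢k ∘ proj₁))
    Z′k≢1+k : Z′ k ≢ suc k
    Z′k≢1+k Z′k≡1+k = <-asym (subst₂ _<_ Zk≡1+k Z1+k≡k asc) (n<1+n k)
      where
      Z1+k≡k : Z (suc k) ≡ k
      Z1+k≡k = sᴺ-injective k (trans (cong (sᴺ k ∘ Z) (sym (sᴺ-left k)))
                                     (trans Z′k≡1+k (sym (sᴺ-left k))))
      Zk≡1+k : Z k ≡ suc k
      Zk≡1+k = trans (cong Z (sym Z1+k≡k)) (Z-involutive (suc k))
    Z′-conj≗Z : sᴺ k ∘ Z′ ∘ sᴺ k ≗ Z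
    Z′-conj≗Z x = trans (sᴺ-involutive k _) (cong Z (sᴺ-involutive k x))
    ℓz<ℓSzS : ℓ z < ℓ ((S · z) · S)
    ℓz<ℓSzS = begin-strict
      ℓ z                              ≡⟨ ℓ≡inversions z ⟩
      inversions n Z                   ≡⟨ inversions-cong n Z′-conj≗Z ⟨
      inversions n (sᴺ k ∘ Z′ ∘ sᴺ k)  <⟨ inversions-conj-< {f = Z′} Z′-involutive Z′-descent Z′k≢1+k 1+k<n ⟩
      inversions n Z′                  ≡⟨ ℓ-SzS ⟨
      ℓ ((S · z) · S)                  ∎
      where open ≤-Reasoning

  InTau⇔descent : Z k ≢ k → InTau (suc k) z ⇔ Z (suc k) < Z k
  InTau⇔descent Zk≢k = mk⇔ (InTau⇒descent Zk≢k) descent⇒InTau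

wᴺ : ℕ → ℕ → ℕ
wᴺ p x with x <? p
... | yes _ = x + p
... | no  _ = x ∸ p

wᴺ-< : ∀ {p x} → x < p → wᴺ p x ≡ x + p
wᴺ-< {p} {x} x<p with x <? p
... | yes _   = refl
... | no  x≮p = contradiction x<p x≮p

wᴺ-≥ : ∀ {p x} → p ≤ x → wᴺ p x ≡ x ∸ p
wᴺ-≥ {p} {x} p≤x with x <? p
... | yes x<p = contradiction p≤x (<⇒≱ x<p)
... | no  _   = refl

wᴺ-bounded : ∀ p {x} → x < p + p → wᴺ p x < p + p
wᴺ-bounded p {x} x<p+p with x <? p
... | yes x<p = +-monoˡ-< p x<p
... | no  _   = ≤-<-trans (m∸n≤m x p) x<p+p

wᴺ-involutive : ∀ p {x} → x < p + p → wᴺ p (wᴺ p x) ≡ x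
wᴺ-involutive p {x} x<p+p with x <? p
... | yes x<p = trans (wᴺ-≥ (m≤n+m p x)) (m+n∸n≡m x p)
... | no  x≮p = trans (wᴺ-< x∸p<p) (m∸n+n≡m (≮⇒≥ x≮p))
  where
  x∸p<p : x ∸ p < p
  x∸p<p = +-cancelʳ-< p (x ∸ p) p (subst (_< p + p) (sym (m∸n+n≡m (≮⇒≥ x≮p))) x<p+p)

wᴺ-no-fixed-point : ∀ p {x} → x < p + p → wᴺ p x ≢ x
wᴺ-no-fixed-point p {x} x<p+p with x <? p
... | yes x<p = >⇒≢ (m<m+n x (≤-<-trans z≤n x<p))
... | no  x≮p = <⇒≢ (∸-monoʳ-< 0<p (≮⇒≥ x≮p))
  where
  0<p : 0 < p
  0<p = +-cancelˡ-< p 0 p (subst (_< p + p) (sym (+-identityʳ p)) (≤-<-trans (≮⇒≥ x≮p) x<p+p))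

wᴺ-descent⇔ : ∀ {p k} → wᴺ p (suc k) < wᴺ p k ⇔ suc k ≡ p
wᴺ-descent⇔ {p} {k} = mk⇔ to from
  where
  open ≤-Reasoning
  to : wᴺ p (suc k) < wᴺ p k → suc k ≡ p
  to desc with <-cmp (suc k) p
  ... | tri< 1+k<p _ _ = contradiction desc (<-asym (begin-strict
    wᴺ p k        ≡⟨ wᴺ-< (<-trans (n<1+n k) 1+k<p) ⟩
    k + p         <⟨ n<1+n (k + p) ⟩
    suc k + p     ≡⟨ wᴺ-< 1+k<p ⟨
    wᴺ p (suc k)  ∎))
  ... | tri≈ _ 1+k≡p _ = 1+k≡p
  ... | tri> _ _ p<1+k = contradiction desc (<-asym (begin-strict
    wᴺ p k        ≡⟨ wᴺ-≥ (s≤s⁻¹ p<1+k) ⟩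
    k ∸ p         <⟨ n<1+n (k ∸ p) ⟩
    suc (k ∸ p)   ≡⟨ +-∸-assoc 1 (s≤s⁻¹ p<1+k) ⟨
    suc k ∸ p     ≡⟨ wᴺ-≥ (<⇒≤ p<1+k) ⟨
    wᴺ p (suc k)  ∎))
  from : suc k ≡ p → wᴺ p (suc k) < wᴺ p k
  from refl = begin-strict
    wᴺ (suc k) (suc k)  ≡⟨ wᴺ-≥ {suc k} ≤-refl ⟩
    suc k ∸ suc k       ≡⟨ n∸n≡0 (suc k) ⟩
    0                   <⟨ <-≤-trans (s≤s z≤n) (m≤n+m (suc k) k) ⟩
    k + suc k           ≡⟨ wᴺ-< (n<1+n k) ⟨
    wᴺ (suc k) k        ∎

ascending-run : ∀ {f : ℕ → ℕ} {b} → (∀ {x} → suc x < b → f x < f (suc x)) →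
                ∀ x d → x + d < b → f x + d ≤ f (x + d)
ascending-run {f} asc x zero _ = ≤-reflexive (trans (+-identityʳ (f x)) (cong f (sym (+-identityʳ x))))
ascending-run {f} {b} asc x (suc d) x+1+d<b = begin
  f x + suc d       ≡⟨ +-suc (f x) d ⟩
  suc (f x + d)     ≤⟨ s≤s (ascending-run asc x d (<-trans (n<1+n (x + d)) 1+x+d<b)) ⟩
  suc (f (x + d))   ≤⟨ asc 1+x+d<b ⟩
  f (suc (x + d))   ≡⟨ cong f (+-suc x d) ⟨
  f (x + suc d)     ∎
  where
  open ≤-Reasoning
  1+x+d<b : suc (x + d) < b
  1+x+d<b = subst (_< b) (+-suc x d) x+1+d<b

ascending⇒increasing : ∀ {f : ℕ → ℕ} {b} → (∀ {x} → suc x < b → f x < f (suc x)) →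
                       ∀ {x y} → x < y → y < b → f x < f y
ascending⇒increasing {f} {b} asc {x} {y} x<y y<b = begin-strict
  f x                ≤⟨ m≤m+n (f x) d ⟩
  f x + d            <⟨ +-monoʳ-< (f x) (n<1+n d) ⟩
  f x + suc d        ≤⟨ ascending-run asc x (suc d) (subst (_< b) (sym x+1+d≡y) y<b) ⟩
  f (x + suc d)      ≡⟨ cong f x+1+d≡y ⟩
  f y                ∎
  where
  open ≤-Reasoning
  d : ℕ
  d = y ∸ suc x
  x+1+d≡y : x + suc d ≡ y
  x+1+d≡y = trans (+-suc x d) (m+[n∸m]≡n x<y)

module _ {p : ℕ} {f : ℕ → ℕ}
         (f-bounded : ∀ {x} → x < p + p → f x < p + p)
         (f-involutive : f ∘ f ≗ id)
         (f-no-fixed-point : ∀ {x} → x < p + p → f x ≢ x)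
         (f-ascent : ∀ {x} → suc x < p + p → suc x ≢ p → f x < f (suc x)) where

  private
    ascent-below-p : ∀ {x} → suc x < p → f x < f (suc x)
    ascent-below-p 1+x<p = f-ascent (<-≤-trans 1+x<p (m≤m+n p p)) (<⇒≢ 1+x<p)

    increasing-below-p : ∀ {x y} → x < y → y < p → f x < f y
    increasing-below-p = ascending⇒increasing ascent-below-p

  -- Otherwise f would exchange two points of [0, p), on which it is increasing.
  lower-half↦upper-half : ∀ {x} → x < p → p ≤ f x
  lower-half↦upper-half {x} x<p with p ≤? f x
  ... | yes p≤fx = p≤fx
  ... | no  p≰fx with <-cmp x (f x)
  ...   | tri< x<fx _ _ =
    contradiction (subst (f x <_) (f-involutive x) (increasing-below-p x<fx (≰⇒> p≰fx))) (<-asym x<fx)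
  ...   | tri≈ _ x≡fx _ = contradiction (sym x≡fx) (f-no-fixed-point (<-≤-trans x<p (m≤m+n p p)))
  ...   | tri> _ _ fx<x =
    contradiction (subst (_< f x) (f-involutive x) (increasing-below-p fx<x x<p)) (<-asym fx<x)

  lower-half : ∀ {x} → x < p → f x ≡ x + p
  lower-half {x} x<p = ≤-antisym upper lower
    where
    open ≤-Reasoning
    lower : x + p ≤ f x
    lower = begin
      x + p      ≡⟨ +-comm x p ⟩
      p + x      ≤⟨ +-monoˡ-≤ x (lower-half↦upper-half (≤-<-trans z≤n x<p)) ⟩
      f 0 + x    ≤⟨ ascending-run ascent-below-p 0 x x<p ⟩
      f x        ∎
    d : ℕ
    d = p ∸ suc x
    1+x+d≡p : suc x + d ≡ p
    1+x+d≡p = m+[n∸m]≡n x<p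
    x+d<p : x + d < p
    x+d<p = subst (x + d <_) 1+x+d≡p (n<1+n (x + d))
    rearrange : ∀ a b c → (suc a + b) + c ≡ suc (a + c) + b
    rearrange = solve-∀
    upper : f x ≤ x + p
    upper = ≤-pred (+-cancelʳ-< d (f x) (suc (x + p)) (begin-strict
      f x + d            ≤⟨ ascending-run ascent-below-p x d x+d<p ⟩
      f (x + d)          <⟨ f-bounded (<-≤-trans x+d<p (m≤m+n p p)) ⟩
      p + p              ≡⟨ cong (_+ p) 1+x+d≡p ⟨
      (suc x + d) + p    ≡⟨ rearrange x d p ⟩
      suc (x + p) + d    ∎))

  upper-half : ∀ {x} → p ≤ x → x < p + p → f x ≡ x ∸ p
  upper-half {x} p≤x x<p+p = begin
    f x                  ≡⟨ cong f (m∸n+n≡m p≤x) ⟨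
    f (x ∸ p + p)        ≡⟨ cong f (lower-half x∸p<p) ⟨
    f (f (x ∸ p))        ≡⟨ f-involutive (x ∸ p) ⟩
    x ∸ p                ∎
    where
    open ≡-Reasoning
    x∸p<p : x ∸ p < p
    x∸p<p = +-cancelʳ-< p (x ∸ p) p (subst (_< p + p) (sym (m∸n+n≡m p≤x)) x<p+p)

  unique-descent⇒≡wᴺ : ∀ {x} → x < p + p → f x ≡ wᴺ p x
  unique-descent⇒≡wᴺ {x} x<p+p with x <? p
  ... | yes x<p = lower-half x<p
  ... | no  x≮p = upper-half (≮⇒≥ x≮p) x<p+p

double≡+ : ∀ p → double p ≡ p + p
double≡+ zero    = refl
double≡+ (suc p) = cong suc (trans (cong suc (double≡+ p)) (sym (+-suc p p)))

<double⇒<+ : ∀ {p x} → x < double p → x < p + p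
<double⇒<+ {p} = subst (_ <_) (double≡+ p)

<+⇒<double : ∀ {p x} → x < p + p → x < double p
<+⇒<double {p} = subst (_ <_) (sym (double≡+ p))

IsW⇒≡wᴺ : ∀ {p} {w : Perm (double p)} → IsW p w → ∀ {x} → x < double p → ⟨ w ⟩ x ≡ wᴺ p x
IsW⇒≡wᴺ {p} {w} (fpf , τ≡p) x<n =
  unique-descent⇒≡wᴺ (<double⇒<+ ∘ ⟨⟩-bounded w ∘ <+⇒<double) (⟨⟩-involutive w-involutive)
                     (⟨⟩-no-fixed-point fpf ∘ <+⇒<double) ascent (<double⇒<+ x<n)
  where
  w-involutive : app w ∘ app w ≗ id
  w-involutive = proj₁ ∘ fpf
  ascent : ∀ {x} → suc x < p + p → suc x ≢ p → ⟨ w ⟩ x < ⟨ w ⟩ (suc x)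
  ascent {x} 1+x<p+p 1+x≢p with <-cmp (⟨ w ⟩ x) (⟨ w ⟩ (suc x))
  ... | tri< asc _ _ = asc
  ... | tri≈ _ wx≡w1+x _ =
    contradiction (involution-injective {f = ⟨ w ⟩} (⟨⟩-involutive w-involutive) (sym wx≡w1+x)) 1+n≢n
  ... | tri> _ _ desc =
    contradiction (Equivalence.to (τ≡p (suc x) (s≤s z≤n) (<+⇒<double 1+x<p+p))
                                  (descent⇒InTau (<+⇒<double 1+x<p+p) w-involutive desc)) 1+x≢p

W : (p : ℕ) → Perm (double p)
W p = tabulate λ i → fromℕ< (<+⇒<double (wᴺ-bounded p (<double⇒<+ (toℕ<n i))))

W-toℕ : ∀ p i → toℕ (app (W p) i) ≡ wᴺ p (toℕ i)
W-toℕ p i = trans (cong toℕ (lookup∘tabulate _ i)) (toℕ-fromℕ< _)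

⟨W⟩ : ∀ p {x} → x < double p → ⟨ W p ⟩ x ≡ wᴺ p x
⟨W⟩ p x<n = trans (⟨⟩-< (W p) x<n) (trans (W-toℕ p _) (cong (wᴺ p) (toℕ-fromℕ< x<n)))

W-IsFPFInv : ∀ p → IsFPFInv (W p)
W-IsFPFInv p i =
  toℕ-injective (trans (W-toℕ p _) (trans (cong (wᴺ p) (W-toℕ p i)) (wᴺ-involutive p i<p+p))) ,
  λ Wi≡i → wᴺ-no-fixed-point p i<p+p (trans (sym (W-toℕ p i)) (cong toℕ Wi≡i))
  where
  i<p+p : toℕ i < p + p
  i<p+p = <double⇒<+ (toℕ<n i)

W-IsW : ∀ p → IsW p (W p)
W-IsW p = W-IsFPFInv p , τ≡p
  where
  τ≡p : ∀ i → 1 ≤ i → i < double p → InTau i (W p) ⇔ (i ≡ p)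
  τ≡p (suc k) _ 1+k<n = wᴺ-descent⇔ ⇔-∘ (⟨W⟩-descent⇔ ⇔-∘ τ⇔descent)
    where
    k<n : k < double p
    k<n = <-trans (n<1+n k) 1+k<n
    τ⇔descent : InTau (suc k) (W p) ⇔ ⟨ W p ⟩ (suc k) < ⟨ W p ⟩ k
    τ⇔descent = InTau⇔descent 1+k<n (proj₁ ∘ W-IsFPFInv p) (⟨⟩-no-fixed-point (W-IsFPFInv p) k<n)
    ⟨W⟩-descent⇔ : ⟨ W p ⟩ (suc k) < ⟨ W p ⟩ k ⇔ wᴺ p (suc k) < wᴺ p k
    ⟨W⟩-descent⇔ = mk⇔ (subst₂ _<_ (⟨W⟩ p 1+k<n) (⟨W⟩ p k<n))
                       (subst₂ _<_ (sym (⟨W⟩ p 1+k<n)) (sym (⟨W⟩ p k<n)))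

∃!W : ∀ p → ∃! _≡_ (IsW p)
∃!W p = W p , W-IsW p , λ w-IsW → ⟨⟩-ext λ x x<n → trans (⟨W⟩ p x<n) (sym (IsW⇒≡wᴺ w-IsW x<n))

σᴺ : ℕ → ℕ → ℕ
σᴺ zero    x = x
σᴺ (suc p) x = sᴺ p (σᴺ p x)

σ⁻¹ᴺ : ℕ → ℕ → ℕ
σ⁻¹ᴺ zero    x = x
σ⁻¹ᴺ (suc p) x = σ⁻¹ᴺ p (sᴺ p x)

⟨σ⟩ : ∀ {n p} → p < n → ⟨ σ n p ⟩ ≗ σᴺ p
⟨σ⟩ {n} {zero}  _     = ⟨identity⟩ {n}
⟨σ⟩ {n} {suc p} 1+p<n x =
  trans (⟨·⟩ (s n (suc p)) (σ n p) x)
        (trans (⟨s⟩ 1+p<n _) (cong (sᴺ p) (⟨σ⟩ (<-trans (n<1+n p) 1+p<n) x)))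

⟨σ⁻¹⟩ : ∀ {n p} → p < n → ⟨ σ⁻¹ n p ⟩ ≗ σ⁻¹ᴺ p
⟨σ⁻¹⟩ {n} {zero}  _     = ⟨identity⟩ {n}
⟨σ⁻¹⟩ {n} {suc p} 1+p<n x =
  trans (⟨·⟩ (σ⁻¹ n p) (s n (suc p)) x)
        (trans (⟨σ⁻¹⟩ (<-trans (n<1+n p) 1+p<n) _) (cong (σ⁻¹ᴺ p) (⟨s⟩ 1+p<n x)))

⟨ν⟩ : ∀ {n p} → p < n → (x : Perm n) → ⟨ ν n p x ⟩ ≗ σᴺ p ∘ ⟨ x ⟩ ∘ σ⁻¹ᴺ p
⟨ν⟩ {n} {p} p<n x t = begin
  ⟨ (σ n p · x) · σ⁻¹ n p ⟩ t              ≡⟨ ⟨·⟩ (σ n p · x) (σ⁻¹ n p) t ⟩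
  ⟨ σ n p · x ⟩ (⟨ σ⁻¹ n p ⟩ t)            ≡⟨ ⟨·⟩ (σ n p) x _ ⟩
  ⟨ σ n p ⟩ (⟨ x ⟩ (⟨ σ⁻¹ n p ⟩ t))        ≡⟨ ⟨σ⟩ p<n _ ⟩
  σᴺ p (⟨ x ⟩ (⟨ σ⁻¹ n p ⟩ t))             ≡⟨ cong (σᴺ p ∘ ⟨ x ⟩) (⟨σ⁻¹⟩ p<n t) ⟩
  σᴺ p (⟨ x ⟩ (σ⁻¹ᴺ p t))                  ∎
  where open ≡-Reasoning

σᴺ-zero : ∀ p → σᴺ p 0 ≡ p
σᴺ-zero zero    = refl
σᴺ-zero (suc p) = trans (cong (sᴺ p) (σᴺ-zero p)) (sᴺ-left p)

σᴺ-above : ∀ p {x} → p < x → σᴺ p x ≡ x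
σᴺ-above zero    _     = refl
σᴺ-above (suc p) 1+p<x = trans (cong (sᴺ p) (σᴺ-above p (<-trans (n<1+n p) 1+p<x))) (sᴺ-above p 1+p<x)

σᴺ-suc : ∀ p {y} → y < p → σᴺ p (suc y) ≡ y
σᴺ-suc (suc p) {y} y<1+p with m≤n⇒m<n∨m≡n (≤-pred y<1+p)
... | inj₁ y<p  = trans (cong (sᴺ p) (σᴺ-suc p y<p)) (sᴺ-below p y<p)
... | inj₂ refl = trans (cong (sᴺ p) (σᴺ-above p (n<1+n p))) (sᴺ-right p)

σ⁻¹ᴺ∘σᴺ : ∀ p x → σ⁻¹ᴺ p (σᴺ p x) ≡ x
σ⁻¹ᴺ∘σᴺ zero    x = refl
σ⁻¹ᴺ∘σᴺ (suc p) x = trans (cong (σ⁻¹ᴺ p) (sᴺ-involutive p _)) (σ⁻¹ᴺ∘σᴺ p x)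

σ⁻¹ᴺ-at : ∀ p → σ⁻¹ᴺ p p ≡ 0
σ⁻¹ᴺ-at p = trans (cong (σ⁻¹ᴺ p) (sym (σᴺ-zero p))) (σ⁻¹ᴺ∘σᴺ p 0)

σ⁻¹ᴺ-below : ∀ p {y} → y < p → σ⁻¹ᴺ p y ≡ suc y
σ⁻¹ᴺ-below p y<p = trans (cong (σ⁻¹ᴺ p) (sym (σᴺ-suc p y<p))) (σ⁻¹ᴺ∘σᴺ p _)

σ⁻¹ᴺ-above : ∀ p {x} → p < x → σ⁻¹ᴺ p x ≡ x
σ⁻¹ᴺ-above p p<x = trans (cong (σ⁻¹ᴺ p) (sym (σᴺ-above p p<x))) (σ⁻¹ᴺ∘σᴺ p _)

module _ {m : ℕ} (z : Perm m) where

  private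
    N : ℕ
    N = suc (suc m)
    rev : ℕ → ℕ
    rev = ⟨ w₀ {N} ⟩

  ⟨ρ⟩ : ⟨ ρ z ⟩ ≗ rev ∘ ⟨ z ⟩ ∘ sᴺ m ∘ rev
  ⟨ρ⟩ t = begin
    ⟨ ((w₀ · embed z) · s N (suc m)) · w₀ ⟩ t    ≡⟨ ⟨·⟩ ((w₀ · embed z) · s N (suc m)) w₀ t ⟩
    ⟨ (w₀ · embed z) · s N (suc m) ⟩ (rev t)     ≡⟨ ⟨·⟩ (w₀ · embed z) (s N (suc m)) (rev t) ⟩
    ⟨ w₀ · embed z ⟩ (⟨ s N (suc m) ⟩ (rev t))   ≡⟨ ⟨·⟩ w₀ (embed z) (⟨ s N (suc m) ⟩ (rev t)) ⟩
    rev (⟨ embed z ⟩ (⟨ s N (suc m) ⟩ (rev t)))  ≡⟨ cong rev (⟨embed⟩ z (⟨ s N (suc m) ⟩ (rev t))) ⟩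
    rev (⟨ z ⟩ (⟨ s N (suc m) ⟩ (rev t)))        ≡⟨ cong (rev ∘ ⟨ z ⟩) (⟨s⟩ (n<1+n (suc m)) (rev t)) ⟩
    rev (⟨ z ⟩ (sᴺ m (rev t)))                   ∎
    where open ≡-Reasoning

  ⟨ρ⟩-0 : ⟨ ρ z ⟩ 0 ≡ 1
  ⟨ρ⟩-0 = begin
    ⟨ ρ z ⟩ 0                    ≡⟨ ⟨ρ⟩ 0 ⟩
    rev (⟨ z ⟩ (sᴺ m (rev 0)))   ≡⟨ cong (rev ∘ ⟨ z ⟩ ∘ sᴺ m) (⟨w₀⟩ (s≤s z≤n)) ⟩
    rev (⟨ z ⟩ (sᴺ m (suc m)))   ≡⟨ cong (rev ∘ ⟨ z ⟩) (sᴺ-right m) ⟩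
    rev (⟨ z ⟩ m)                ≡⟨ cong rev (⟨⟩-≥ z ≤-refl) ⟩
    rev m                        ≡⟨ ⟨w₀⟩ (m<n+m m (s≤s z≤n)) ⟩
    suc m ∸ m                    ≡⟨ m+n∸n≡m 1 m ⟩
    1                            ∎
    where open ≡-Reasoning

  ⟨ρ⟩-1 : ⟨ ρ z ⟩ 1 ≡ 0
  ⟨ρ⟩-1 = begin
    ⟨ ρ z ⟩ 1                    ≡⟨ ⟨ρ⟩ 1 ⟩
    rev (⟨ z ⟩ (sᴺ m (rev 1)))   ≡⟨ cong (rev ∘ ⟨ z ⟩ ∘ sᴺ m) (⟨w₀⟩ (s≤s (s≤s z≤n))) ⟩
    rev (⟨ z ⟩ (sᴺ m m))         ≡⟨ cong (rev ∘ ⟨ z ⟩) (sᴺ-left m) ⟩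
    rev (⟨ z ⟩ (suc m))          ≡⟨ cong rev (⟨⟩-≥ z (n≤1+n m)) ⟩
    rev (suc m)                  ≡⟨ ⟨w₀⟩ (n<1+n (suc m)) ⟩
    suc m ∸ suc m                ≡⟨ n∸n≡0 (suc m) ⟩
    0                            ∎
    where open ≡-Reasoning

  ⟨ρ⟩-suc-suc : ∀ {i} → i < m → ⟨ ρ z ⟩ (suc (suc i)) ≡ suc m ∸ ⟨ z ⟩ (m ∸ suc i)
  ⟨ρ⟩-suc-suc {i} i<m = begin
    ⟨ ρ z ⟩ (suc (suc i))                 ≡⟨ ⟨ρ⟩ (suc (suc i)) ⟩
    rev (⟨ z ⟩ (sᴺ m (rev (suc (suc i)))))  ≡⟨ cong (rev ∘ ⟨ z ⟩ ∘ sᴺ m) (⟨w₀⟩ (s≤s (s≤s i<m))) ⟩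
    rev (⟨ z ⟩ (sᴺ m (m ∸ suc i)))        ≡⟨ cong (rev ∘ ⟨ z ⟩) (sᴺ-below m m∸1+i<m) ⟩
    rev (⟨ z ⟩ (m ∸ suc i))               ≡⟨ ⟨w₀⟩ (<-trans (⟨⟩-bounded z m∸1+i<m) (m<n+m m (s≤s z≤n))) ⟩
    suc m ∸ ⟨ z ⟩ (m ∸ suc i)             ∎
    where
    open ≡-Reasoning
    m∸1+i<m : m ∸ suc i < m
    m∸1+i<m = ∸-monoʳ-< (s≤s z≤n) i<m

+≡⇒∸≡ : ∀ {a b c} → a + b ≡ c → c ∸ b ≡ a
+≡⇒∸≡ {a} {b} refl = m+n∸n≡m a b

module _ {k : ℕ} {w′ : Perm (double k)} (w′≡wᴺ : ∀ {u} → u < double k → ⟨ w′ ⟩ u ≡ wᴺ k u) where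

  private
    m n p : ℕ
    m = double k
    n = double (suc k)
    p = suc k
    <k⇒<m : ∀ {u} → u < k → u < m
    <k⇒<m u<k = <+⇒<double (≤-trans u<k (m≤m+n k k))
    ⟨νρw′⟩ : ⟨ ν n p (ρ w′) ⟩ ≗ σᴺ p ∘ ⟨ ρ w′ ⟩ ∘ σ⁻¹ᴺ p
    ⟨νρw′⟩ = ⟨ν⟩ (s≤s (s≤s (subst (k ≤_) (sym (double≡+ k)) (m≤m+n k k)))) (ρ w′)

  ρw′-lower : ∀ {i} → i < k → ⟨ ρ w′ ⟩ (suc (suc i)) ≡ suc (suc (i + k))
  ρw′-lower {i} i<k = begin
    ⟨ ρ w′ ⟩ (suc (suc i))          ≡⟨ ⟨ρ⟩-suc-suc w′ (<k⇒<m i<k) ⟩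
    suc m ∸ ⟨ w′ ⟩ (m ∸ suc i)      ≡⟨ cong (λ u → suc m ∸ ⟨ w′ ⟩ u) (+≡⇒∸≡ r+k+1+i≡m) ⟩
    suc m ∸ ⟨ w′ ⟩ (r + k)          ≡⟨ cong (suc m ∸_) w′[r+k]≡r ⟩
    suc m ∸ r                       ≡⟨ +≡⇒∸≡ 2+i+k+r≡1+m ⟩
    suc (suc (i + k))               ∎
    where
    open ≡-Reasoning
    -- Writing k = (i + 1) + r makes both truncated subtractions exact.
    r : ℕ
    r = k ∸ suc i
    1+i+r≡k : suc i + r ≡ k
    1+i+r≡k = m+[n∸m]≡n i<k
    k+k≡m : k + (suc i + r) ≡ m
    k+k≡m = trans (cong (k +_) 1+i+r≡k) (sym (double≡+ k))
    r<k : r < k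
    r<k = subst (r <_) 1+i+r≡k (m<n+m r (s≤s z≤n))
    r+k+1+i≡m : (r + k) + suc i ≡ m
    r+k+1+i≡m = trans (rearrange r k i) k+k≡m
      where
      rearrange : ∀ a b c → (a + b) + suc c ≡ b + (suc c + a)
      rearrange = solve-∀
    2+i+k+r≡1+m : suc (suc (i + k)) + r ≡ suc m
    2+i+k+r≡1+m = trans (rearrange i k r) (cong suc k+k≡m)
      where
      rearrange : ∀ a b c → suc (suc (a + b)) + c ≡ suc (b + (suc a + c))
      rearrange = solve-∀
    w′[r+k]≡r : ⟨ w′ ⟩ (r + k) ≡ r
    w′[r+k]≡r = begin
      ⟨ w′ ⟩ (r + k)  ≡⟨ w′≡wᴺ (<+⇒<double (+-monoˡ-< k r<k)) ⟩
      wᴺ k (r + k)    ≡⟨ wᴺ-≥ (m≤n+m k r) ⟩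
      r + k ∸ k       ≡⟨ m+n∸n≡m r k ⟩
      r               ∎

  ρw′-upper : ∀ {q} → q < k → ⟨ ρ w′ ⟩ (suc (suc (k + q))) ≡ suc (suc q)
  ρw′-upper {q} q<k = begin
    ⟨ ρ w′ ⟩ (suc (suc (k + q)))    ≡⟨ ⟨ρ⟩-suc-suc w′ (<+⇒<double (+-monoʳ-< k q<k)) ⟩
    suc m ∸ ⟨ w′ ⟩ (m ∸ suc (k + q))  ≡⟨ cong (λ u → suc m ∸ ⟨ w′ ⟩ u) (+≡⇒∸≡ r+1+k+q≡m) ⟩
    suc m ∸ ⟨ w′ ⟩ r                ≡⟨ cong (suc m ∸_) (trans (w′≡wᴺ (<k⇒<m r<k)) (wᴺ-< r<k)) ⟩
    suc m ∸ (r + k)                 ≡⟨ +≡⇒∸≡ 2+q+r+k≡1+m ⟩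
    suc (suc q)                     ∎
    where
    open ≡-Reasoning
    r : ℕ
    r = k ∸ suc q
    1+q+r≡k : suc q + r ≡ k
    1+q+r≡k = m+[n∸m]≡n q<k
    r<k : r < k
    r<k = subst (r <_) 1+q+r≡k (m<n+m r (s≤s z≤n))
    k+k≡m : k + (suc q + r) ≡ m
    k+k≡m = trans (cong (k +_) 1+q+r≡k) (sym (double≡+ k))
    r+1+k+q≡m : r + suc (k + q) ≡ m
    r+1+k+q≡m = trans (rearrange r k q) k+k≡m
      where
      rearrange : ∀ a b c → a + suc (b + c) ≡ b + (suc c + a)
      rearrange = solve-∀
    2+q+r+k≡1+m : suc (suc q) + (r + k) ≡ suc m
    2+q+r+k≡1+m = trans (rearrange q r k) (cong suc k+k≡m)
      where
      rearrange : ∀ a b c → suc (suc a) + (b + c) ≡ suc (c + (suc a + b))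
      rearrange = solve-∀
  νρw′-0 : ⟨ ν n p (ρ w′) ⟩ 0 ≡ wᴺ p 0
  νρw′-0 = begin
    ⟨ ν n p (ρ w′) ⟩ 0        ≡⟨ ⟨νρw′⟩ 0 ⟩
    σᴺ p (⟨ ρ w′ ⟩ (σ⁻¹ᴺ p 0))  ≡⟨ cong (σᴺ p ∘ ⟨ ρ w′ ⟩) (σ⁻¹ᴺ-below p (s≤s z≤n)) ⟩
    σᴺ p (⟨ ρ w′ ⟩ 1)           ≡⟨ cong (σᴺ p) (⟨ρ⟩-1 w′) ⟩
    σᴺ p 0                      ≡⟨ σᴺ-zero p ⟩
    p                           ≡⟨ wᴺ-< (s≤s z≤n) ⟨
    wᴺ p 0                      ∎
    where open ≡-Reasoning

  νρw′-lower : ∀ {i} → i < k → ⟨ ν n p (ρ w′) ⟩ (suc i) ≡ wᴺ p (suc i)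
  νρw′-lower {i} i<k = begin
    ⟨ ν n p (ρ w′) ⟩ (suc i)          ≡⟨ ⟨νρw′⟩ (suc i) ⟩
    σᴺ p (⟨ ρ w′ ⟩ (σ⁻¹ᴺ p (suc i)))  ≡⟨ cong (σᴺ p ∘ ⟨ ρ w′ ⟩) (σ⁻¹ᴺ-below p (s≤s i<k)) ⟩
    σᴺ p (⟨ ρ w′ ⟩ (suc (suc i)))     ≡⟨ cong (σᴺ p) (ρw′-lower i<k) ⟩
    σᴺ p (suc (suc (i + k)))          ≡⟨ σᴺ-above p (s≤s (s≤s (m≤n+m k i))) ⟩
    suc (suc (i + k))                 ≡⟨ cong suc (+-suc i k) ⟨
    suc i + p                         ≡⟨ wᴺ-< (s≤s i<k) ⟨
    wᴺ p (suc i)                      ∎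
    where open ≡-Reasoning

  νρw′-at-p : ⟨ ν n p (ρ w′) ⟩ p ≡ wᴺ p p
  νρw′-at-p = begin
    ⟨ ν n p (ρ w′) ⟩ p          ≡⟨ ⟨νρw′⟩ p ⟩
    σᴺ p (⟨ ρ w′ ⟩ (σ⁻¹ᴺ p p))  ≡⟨ cong (σᴺ p ∘ ⟨ ρ w′ ⟩) (σ⁻¹ᴺ-at p) ⟩
    σᴺ p (⟨ ρ w′ ⟩ 0)           ≡⟨ cong (σᴺ p) (⟨ρ⟩-0 w′) ⟩
    σᴺ p 1                      ≡⟨ σᴺ-suc p (s≤s z≤n) ⟩
    0                           ≡⟨ n∸n≡0 p ⟨
    p ∸ p                       ≡⟨ wᴺ-≥ {p} ≤-refl ⟨
    wᴺ p p                      ∎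
    where open ≡-Reasoning

  νρw′-upper : ∀ {q} → q < k → ⟨ ν n p (ρ w′) ⟩ (suc p + q) ≡ wᴺ p (suc p + q)
  νρw′-upper {q} q<k = begin
    ⟨ ν n p (ρ w′) ⟩ (suc p + q)          ≡⟨ ⟨νρw′⟩ (suc p + q) ⟩
    σᴺ p (⟨ ρ w′ ⟩ (σ⁻¹ᴺ p (suc p + q)))  ≡⟨ cong (σᴺ p ∘ ⟨ ρ w′ ⟩) (σ⁻¹ᴺ-above p (m≤m+n (suc p) q)) ⟩
    σᴺ p (⟨ ρ w′ ⟩ (suc p + q))           ≡⟨ cong (σᴺ p) (ρw′-upper q<k) ⟩
    σᴺ p (suc (suc q))                    ≡⟨ σᴺ-suc p (s≤s q<k) ⟩
    suc q                                 ≡⟨ m+n∸m≡n p (suc q) ⟨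
    p + suc q ∸ p                         ≡⟨ cong (_∸ p) (+-suc p q) ⟩
    suc p + q ∸ p                         ≡⟨ wᴺ-≥ (≤-trans (n≤1+n p) (m≤m+n (suc p) q)) ⟨
    wᴺ p (suc p + q)                      ∎
    where open ≡-Reasoning

  ν-ρw′≡wᴺ : ∀ {t} → t < n → ⟨ ν n p (ρ w′) ⟩ t ≡ wᴺ p t
  ν-ρw′≡wᴺ {zero}  _        = νρw′-0
  ν-ρw′≡wᴺ {suc i} 1+i<2k+2 with <-cmp i k
  ... | tri< i<k _ _ = νρw′-lower i<k
  ... | tri≈ _ refl _ = νρw′-at-p
  ... | tri> _ _ k<i = subst (λ t → ⟨ ν n p (ρ w′) ⟩ t ≡ wᴺ p t) (cong suc 1+k+q≡i) (νρw′-upper q<k)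
    where
    1+k+q≡i : suc k + (i ∸ suc k) ≡ i
    1+k+q≡i = m+[n∸m]≡n k<i
    q<k : i ∸ suc k < k
    q<k = +-cancelˡ-< k (i ∸ suc k) k (subst (k + (i ∸ suc k) <_) (double≡+ k)
            (s<s⁻¹ (subst (_< suc (double k)) (sym 1+k+q≡i) (s<s⁻¹ 1+i<2k+2))))

IsW-recursion : ∀ {k} {w′ : Perm (double k)} {w : Perm (double (suc k))} →
                IsW k w′ → IsW (suc k) w → w ≡ ν (double (suc k)) (suc k) (ρ w′)
IsW-recursion w′-IsW w-IsW =
  ⟨⟩-ext λ t t<n → trans (IsW⇒≡wᴺ w-IsW t<n) (sym (ν-ρw′≡wᴺ (IsW⇒≡wᴺ w′-IsW) t<n))

mainTheorem8 : (∀ (p : ℕ) → 1 ≤ p → ∃! _≡_ (λ w → IsW p w))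
    × (∀ (k : ℕ) → 1 ≤ k → ∀ (w' : Perm (double k)) → IsW k w'
         → ∀ (w : Perm (double (suc k))) → IsW (suc k) w
         → w ≡ ν (double (suc k)) (suc k) (ρ w'))
mainTheorem8 = (λ p _ → ∃!W p) , (λ k _ w′ w′-IsW w w-IsW → IsW-recursion w′-IsW w-IsW)
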